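{- Every partition of $n\ge 1$ is $(i,1)$-equivalent to a strict partition.
   Context: Partitions are identified with Ferrers boards; box $(i,j)$ is in row $i$ from the top and column $j$ from the left. For a box $(i,j)$ of a partition $\mu$, if replacing the subboard $\{(x,y)\in\mu: x\ge i,\ y\ge j\}$ by its conjugate (transpose, anchored at box $(i,j)$) yields a partition, this new partition is called the $(i,j)$-transform of $\mu$. Two partitions are $(i,1)$-equivalent if one can be obtained from the other by a sequence of $(i,1)$-transformations (with $i$ allowed to vary). A partition is strict if its nonzero parts are pairwise distinct. -}

module Defs where

open import Data.Nat using (ℕ; zero; suc; _+_; _∸_; _≤_; _≥_; _<_)
open import Data.List using (List; []; _∷_)
open import Data.Nat.ListAction using (sum)
open import Relation.Binary.PropositionalEquality using (_≡_)
open import Data.List.Relation.Unary.All using (All)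
open import Data.List.Relation.Unary.Linked using (Linked)
open import Data.List.Relation.Unary.Unique.Propositional using (Unique)
open import Data.Product using (_×_; Σ)
open import Data.Sum using (_⊎_)
open import Relation.Nullary using (¬_)
open import Relation.Binary.Construct.Closure.ReflexiveTransitive using (Star)

IsPartition : List ℕ → Set
IsPartition μ = All (λ a → 1 ≤ a) μ × Linked _≥_ μ

IsPartitionOf : ℕ → List ℕ → Set
IsPartitionOf n μ = IsPartition μ × sum μ ≡ n

-- length of row x (1-based); 0 if the row does not exist
rowLen : List ℕ → ℕ → ℕ
rowLen []      _             = 0
rowLen (a ∷ μ) zero          = 0
rowLen (a ∷ μ) (suc zero)    = a
rowLen (a ∷ μ) (suc (suc k)) = rowLen μ (suc k)

-- box (x , y) (row x from the top, column y from the left, 1-based)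
-- lies in the Ferrers board of μ
InBoard : List ℕ → ℕ → ℕ → Set
InBoard μ x y = 1 ≤ y × y ≤ rowLen μ x

-- the board obtained from μ by replacing the subboard
-- {(x,y) ∈ μ : x ≥ i, y ≥ j} by its transpose anchored at (i,j)
TransformedBoard : ℕ → ℕ → List ℕ → ℕ → ℕ → Set
TransformedBoard i j μ x y =
  (i ≤ x × j ≤ y × InBoard μ (i + (y ∸ j)) (j + (x ∸ i)))
  ⊎ (¬ (i ≤ x × j ≤ y) × InBoard μ x y)

IsTransform : ℕ → ℕ → List ℕ → List ℕ → Set
IsTransform i j μ ν =
  InBoard μ i j × IsPartition ν
  × (∀ x y → (InBoard ν x y → TransformedBoard i j μ x y)
             × (TransformedBoard i j μ x y → InBoard ν x y))

Step : List ℕ → List ℕ → Set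
Step μ ν = Σ ℕ (λ i → IsTransform i 1 μ ν)

Equiv₁ : List ℕ → List ℕ → Set
Equiv₁ μ ν = Star Step μ ν ⊎ Star Step ν μ

-- strict: nonzero parts pairwise distinct (all parts are nonzero here)
IsStrict : List ℕ → Set
IsStrict μ = Unique μ

module Submission where

-- Write conj β for the conjugate of a partition β, and maxDiag ρ for the largest
-- value of x + y - 1 over the boxes (x,y) of ρ, i.e. the last anti-diagonal the
-- Ferrers board of ρ reaches.  The argument rests on two general facts:
--   * if the parts of α are all at least the length of β, then α ++ conj β is the
--     (|α|+1,1)-transform of α ++ β (conjugateTail-isTransform);
--   * an (i,j)-transform moves boxes along anti-diagonals, so it preserves every
--     bound x + y ≤ K on the boxes of a board (transform-preserves-diag).
-- Keep a prefix π fixed and work on the suffix ρ.  Choose a row b of ρ attaining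
-- maxDiag ρ, so ρ = α ++ b ∷ β' with M = b + |α| = maxDiag ρ.  Conjugating b ∷ β'
-- and then the whole new suffix produces a suffix M ∷ τ whose remaining parts lie
-- below the anti-diagonal M + 1, whence maxDiag τ < M (raise).  Freezing M into
-- the prefix and recursing on τ, whose sum is smaller (strictify), yields a
-- strictly decreasing suffix; started from the empty prefix this is lemma9.

open import Defs
open import Data.Nat using (ℕ; zero; suc; _+_; _∸_; _≤_; _<_; _≥_; _>_; z≤n; s≤s; _≤?_; _⊔_; _⊓_)
open import Data.Nat.Properties
open import Data.Nat.ListAction using (sum)
open import Data.Nat.ListAction.Properties using (sum-++)
open import Data.Nat.Tactic.RingSolver using (solve-∀)
open import Data.List using (List; []; _∷_; _++_; _∷ʳ_; [_]; length; map; applyUpTo)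
open import Data.List.Properties using (length-applyUpTo; applyUpTo-∷ʳ; map-id-local; ++-assoc; length-++)
open import Data.List.Relation.Unary.All using (All; []; _∷_)
import Data.List.Relation.Unary.All as All
import Data.List.Relation.Unary.All.Properties as All
import Data.List.Relation.Unary.AllPairs as AllPairs
open import Data.List.Relation.Unary.Linked using (Linked; []; [-]; _∷_)
import Data.List.Relation.Unary.Linked as Linked
import Data.List.Relation.Unary.Linked.Properties as Linkedₚ
open import Data.Product using (Σ; _×_; _,_; proj₁; proj₂)
open import Data.Sum using (inj₁; inj₂)
open import Function using (_∘_; flip)
open import Function.Bundles using (_⇔_; mk⇔; Equivalence)
open import Relation.Binary.Construct.Closure.ReflexiveTransitive using (Star; ε; _◅_; _◅◅_)
open import Relation.Nullary using (¬_; yes; no; contradiction)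
open import Relation.Binary.PropositionalEquality
  using (_≡_; refl; sym; trans; cong; cong₂; subst; subst₂; module ≡-Reasoning)

Decreasing : List ℕ → Set
Decreasing = Linked _≥_

firstPart : List ℕ → ℕ
firstPart []      = 0
firstPart (a ∷ _) = a

-- count x β: the number of parts of β that are at least x, i.e. the length of
-- column x of the Ferrers board of β.
count : ℕ → List ℕ → ℕ
count x []      = 0
count x (a ∷ β) with x ≤? a
... | yes _ = suc (count x β)
... | no  _ = count x β

columns : ℕ → List ℕ → List ℕ
columns w β = applyUpTo (λ k → count (suc k) β) w

conj : List ℕ → List ℕ
conj β = columns (firstPart β) β

parts≤first : ∀ {β} → Decreasing β → All (_≤ firstPart β) β
parts≤first {[]}    _  = []
parts≤first {a ∷ β} lk = Linkedₚ.Linked⇒All (flip ≤-trans) ≤-refl lk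

rowLen≤first : ∀ {β} → Decreasing β → ∀ y → rowLen β y ≤ firstPart β
rowLen≤first {[]}        _          y             = z≤n
rowLen≤first {a ∷ β}     _          zero          = z≤n
rowLen≤first {a ∷ β}     _          (suc zero)    = ≤-refl
rowLen≤first {a ∷ []}    _          (suc (suc k)) = z≤n
rowLen≤first {a ∷ b ∷ β} (b≤a ∷ lk) (suc (suc k)) = ≤-trans (rowLen≤first lk (suc k)) b≤a

count-below : ∀ {x β} → All (_< x) β → count x β ≡ 0
count-below             []          = refl
count-below {x} {a ∷ β} (a<x ∷ β<x) with x ≤? a
... | yes x≤a = contradiction x≤a (<⇒≱ a<x)
... | no  _   = count-below β<x

count-antitone : ∀ β {x x'} → x ≤ x' → count x' β ≤ count x β
count-antitone []      _ = z≤n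
count-antitone (a ∷ β) {x} {x'} x≤x' with x' ≤? a | x ≤? a
... | yes _    | yes _   = s≤s (count-antitone β x≤x')
... | yes x'≤a | no  x≰a = contradiction (≤-trans x≤x' x'≤a) x≰a
... | no  _    | yes _   = m≤n⇒m≤1+n (count-antitone β x≤x')
... | no  _    | no  _   = count-antitone β x≤x'

count-one : ∀ {β} → All (1 ≤_) β → count 1 β ≡ length β
count-one         []         = refl
count-one {a ∷ β} (1≤a ∷ ps) with 1 ≤? a
... | yes _   = cong suc (count-one ps)
... | no  1≰a = contradiction 1≤a 1≰a

-- Ferrers duality: column x has at least y boxes exactly when row y has at least
-- x boxes.  This is what makes conj the transpose of the board.
ferrers : ∀ {β} → Decreasing β → ∀ {x y} → 1 ≤ x → 1 ≤ y → (y ≤ count x β ⇔ x ≤ rowLen β y)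
ferrers {[]} _ 1≤x 1≤y = mk⇔ (λ y≤0 → contradiction y≤0 (<⇒≱ 1≤y)) (λ x≤0 → contradiction x≤0 (<⇒≱ 1≤x))
ferrers {a ∷ β} lk {x} {y} 1≤x 1≤y with x ≤? a
ferrers {a ∷ β} lk {x} {suc zero}    _   _   | yes x≤a = mk⇔ (λ _ → x≤a) (λ _ → s≤s z≤n)
ferrers {a ∷ β} lk {x} {suc (suc k)} 1≤x _   | yes x≤a =
  mk⇔ (Equivalence.to below ∘ ≤-pred) (s≤s ∘ Equivalence.from below)
  where below = ferrers (Linked.tail lk) 1≤x (s≤s z≤n)
ferrers {a ∷ β} lk {x} {y} 1≤x 1≤y | no x≰a =
  mk⇔ (λ y≤count → contradiction (subst (y ≤_) count≡0 y≤count) (<⇒≱ 1≤y))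
      (λ x≤row → contradiction (≤-trans x≤row (rowLen≤first lk y)) x≰a)
  where
  count≡0 : count x β ≡ 0
  count≡0 = count-below (All.map (λ b≤a → ≤-<-trans b≤a (≰⇒> x≰a)) (All.tail (parts≤first lk)))

rowLen-applyUpTo : ∀ f n k → (∀ j → n ≤ j → f j ≡ 0) → rowLen (applyUpTo f n) (suc k) ≡ f k
rowLen-applyUpTo f zero    k       vanish = sym (vanish k z≤n)
rowLen-applyUpTo f (suc n) zero    vanish = refl
rowLen-applyUpTo f (suc n) (suc k) vanish =
  rowLen-applyUpTo (f ∘ suc) n k (λ j n≤j → vanish (suc j) (s≤s n≤j))

rowLen-conj : ∀ {β} → Decreasing β → ∀ k → rowLen (conj β) (suc k) ≡ count (suc k) β
rowLen-conj {β} lk k = rowLen-applyUpTo _ (firstPart β) k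
  (λ j first≤j → count-below (All.map (λ b≤first → s≤s (≤-trans b≤first first≤j)) (parts≤first lk)))

length-conj : ∀ β → length (conj β) ≡ firstPart β
length-conj β = length-applyUpTo _ (firstPart β)

firstPart-conj : ∀ {β} → All (1 ≤_) β → firstPart (conj β) ≡ length β
firstPart-conj {[]}        _          = refl
firstPart-conj {suc a ∷ β} positive = count-one positive
firstPart-conj {zero ∷ β}  (() ∷ _)

conj-head : ∀ {b β'} → All (1 ≤_) (b ∷ β') → Σ (List ℕ) λ τ → conj (b ∷ β') ≡ length (b ∷ β') ∷ τ
conj-head {suc a} {β'} positive = τ , cong (_∷ τ) (count-one positive)
  where τ = applyUpTo (λ k → count (suc (suc k)) (suc a ∷ β')) a
conj-head {zero} (() ∷ _)

conj-partition : ∀ {β} → IsPartition β → IsPartition (conj β)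
conj-partition {β} (_ , lk) = positive β , decreasing
  where
  positive : ∀ β → All (1 ≤_) (conj β)
  positive []      = []
  positive (a ∷ β) = All.applyUpTo⁺₁ _ a column-nonempty
    where
    column-nonempty : ∀ {k} → k < a → 1 ≤ count (suc k) (a ∷ β)
    column-nonempty {k} k<a with suc k ≤? a
    ... | yes _   = s≤s z≤n
    ... | no  k≮a = contradiction k<a k≮a
  decreasing : Decreasing (conj β)
  decreasing = Linkedₚ.applyUpTo⁺₂ _ (firstPart β) (λ i → count-antitone β (n≤1+n (suc i)))

sum-map-suc⊓ : ∀ w β → sum (map (suc w ⊓_) β) ≡ sum (map (w ⊓_) β) + count (suc w) β
sum-map-suc⊓ w []      = refl
sum-map-suc⊓ w (b ∷ β) with suc w ≤? b | sum-map-suc⊓ w β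
... | yes w<b | ih = begin
  suc w ⊓ b + sum (map (suc w ⊓_) β)               ≡⟨ cong₂ _+_ (m≤n⇒m⊓n≡m w<b) ih ⟩
  suc w + (sum (map (w ⊓_) β) + count (suc w) β)   ≡⟨ rearrange w _ _ ⟩
  w + sum (map (w ⊓_) β) + suc (count (suc w) β)   ≡⟨ cong (λ m → m + sum (map (w ⊓_) β) + _)
                                                          (sym (m≤n⇒m⊓n≡m (<⇒≤ w<b))) ⟩
  w ⊓ b + sum (map (w ⊓_) β) + suc (count (suc w) β) ∎
  where
  open ≡-Reasoning
  rearrange : ∀ w s c → suc w + (s + c) ≡ w + s + suc c
  rearrange = solve-∀
... | no w≮b | ih = begin
  suc w ⊓ b + sum (map (suc w ⊓_) β)               ≡⟨ cong₂ _+_ (m≥n⇒m⊓n≡n b≤suc-w) ih ⟩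
  b + (sum (map (w ⊓_) β) + count (suc w) β)       ≡⟨ sym (+-assoc b _ _) ⟩
  b + sum (map (w ⊓_) β) + count (suc w) β         ≡⟨ cong (λ m → m + sum (map (w ⊓_) β) + _)
                                                          (sym (m≥n⇒m⊓n≡n (≮⇒≥ w≮b))) ⟩
  w ⊓ b + sum (map (w ⊓_) β) + count (suc w) β     ∎
  where
  open ≡-Reasoning
  b≤suc-w : b ≤ suc w
  b≤suc-w = m≤n⇒m≤1+n (≮⇒≥ w≮b)

sum-columns : ∀ w β → sum (columns w β) ≡ sum (map (w ⊓_) β)
sum-columns zero    β = sym (sum-zeros β)
  where
  sum-zeros : ∀ β → sum (map (0 ⊓_) β) ≡ 0
  sum-zeros []      = refl
  sum-zeros (_ ∷ β) = sum-zeros β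
sum-columns (suc w) β = begin
  sum (columns (suc w) β)                         ≡⟨ cong sum (sym (applyUpTo-∷ʳ _ w)) ⟩
  sum (columns w β ∷ʳ count (suc w) β)            ≡⟨ sum-++ (columns w β) [ count (suc w) β ] ⟩
  sum (columns w β) + (count (suc w) β + 0)       ≡⟨ cong₂ _+_ (sum-columns w β) (+-identityʳ _) ⟩
  sum (map (w ⊓_) β) + count (suc w) β            ≡⟨ sym (sum-map-suc⊓ w β) ⟩
  sum (map (suc w ⊓_) β)                          ∎
  where open ≡-Reasoning

sum-conj : ∀ {β} → Decreasing β → sum (conj β) ≡ sum β
sum-conj {β} lk = trans (sum-columns (firstPart β) β)
  (cong sum (map-id-local (All.map (m≥n⇒m⊓n≡n) (parts≤first lk))))

decreasing-++⁺ : ∀ α {β} → Decreasing α → Decreasing β → All (firstPart β ≤_) α → Decreasing (α ++ β)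
decreasing-++⁺ []           _           lb _           = lb
decreasing-++⁺ (a ∷ [])     {[]}    _   _  _           = [-]
decreasing-++⁺ (a ∷ [])     {b ∷ β} _   lb (b≤a ∷ [])  = b≤a ∷ lb
decreasing-++⁺ (a ∷ a' ∷ α) (a'≤a ∷ la) lb (_ ∷ above) = a'≤a ∷ decreasing-++⁺ (a' ∷ α) la lb above

decreasing-++⁻ : ∀ α {β} → Decreasing (α ++ β) → Decreasing α × Decreasing β × All (firstPart β ≤_) α
decreasing-++⁻ []           lk                 = [] , lk , []
decreasing-++⁻ (a ∷ [])     {[]}    _          = [-] , [] , z≤n ∷ []
decreasing-++⁻ (a ∷ [])     {b ∷ β} (b≤a ∷ lk) = [-] , lk , b≤a ∷ []
decreasing-++⁻ (a ∷ a' ∷ α) (a'≤a ∷ lk) with decreasing-++⁻ (a' ∷ α) lk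
... | la , lb , above@(first≤a' ∷ _) = a'≤a ∷ la , lb , ≤-trans first≤a' a'≤a ∷ above

partition-suffix : ∀ π {ρ} → IsPartition (π ++ ρ) → IsPartition ρ
partition-suffix π (positive , lk) = All.++⁻ʳ π positive , proj₁ (proj₂ (decreasing-++⁻ π lk))

rowLen-++ˡ : ∀ α β x → x ≤ length α → rowLen (α ++ β) x ≡ rowLen α x
rowLen-++ˡ []      β zero          _         = rowLen-zero β
  where
  rowLen-zero : ∀ β → rowLen β 0 ≡ 0
  rowLen-zero []      = refl
  rowLen-zero (_ ∷ _) = refl
rowLen-++ˡ (a ∷ α) β zero          _         = refl
rowLen-++ˡ (a ∷ α) β (suc zero)    _         = refl
rowLen-++ˡ (a ∷ α) β (suc (suc k)) (s≤s k<) = rowLen-++ˡ α β (suc k) k<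

rowLen-++ʳ : ∀ α β k → rowLen (α ++ β) (suc (length α + k)) ≡ rowLen β (suc k)
rowLen-++ʳ []      β k = refl
rowLen-++ʳ (a ∷ α) β k = rowLen-++ʳ α β k

-- Rows within α are untouched when the tail β is conjugated: there the new board
-- agrees with the old one and lies outside the transformed subboard.
conjugateTail-upper : ∀ α β {x y} → x ≤ length α →
  (InBoard (α ++ conj β) x y → TransformedBoard (suc (length α)) 1 (α ++ β) x y)
  × (TransformedBoard (suc (length α)) 1 (α ++ β) x y → InBoard (α ++ conj β) x y)
conjugateTail-upper α β {x} {y} x≤A = (λ box → inj₂ (outside , transport box)) , inside
  where
  same-row : rowLen (α ++ conj β) x ≡ rowLen (α ++ β) x
  same-row = trans (rowLen-++ˡ α (conj β) x x≤A) (sym (rowLen-++ˡ α β x x≤A))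
  outside : ¬ (suc (length α) ≤ x × 1 ≤ y)
  outside (A<x , _) = <⇒≱ A<x x≤A
  transport : InBoard (α ++ conj β) x y → InBoard (α ++ β) x y
  transport (1≤y , y≤) = 1≤y , subst (y ≤_) same-row y≤
  inside : TransformedBoard (suc (length α)) 1 (α ++ β) x y → InBoard (α ++ conj β) x y
  inside (inj₁ (A<x , _))         = contradiction x≤A (<⇒≱ A<x)
  inside (inj₂ (_ , (1≤y , y≤))) = 1≤y , subst (y ≤_) (sym same-row) y≤

-- Below α, box (|α|+1+k, y+1) of α ++ conj β corresponds to the transposed box
-- (|α|+1+y, k+1) of α ++ β, by Ferrers duality for β.
conjugateTail-lower : ∀ α {β} → Decreasing β → ∀ k y →
  (InBoard (α ++ conj β) (suc (length α + k)) (suc y)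
     → TransformedBoard (suc (length α)) 1 (α ++ β) (suc (length α + k)) (suc y))
  × (TransformedBoard (suc (length α)) 1 (α ++ β) (suc (length α + k)) (suc y)
     → InBoard (α ++ conj β) (suc (length α + k)) (suc y))
conjugateTail-lower α {β} lb k y = to , from
  where
  A = length α
  column : (A + k) ∸ A ≡ k
  column = m+n∸m≡n A k
  row-ν : rowLen (α ++ conj β) (suc (A + k)) ≡ count (suc k) β
  row-ν = trans (rowLen-++ʳ α (conj β) k) (rowLen-conj lb k)
  row-μ : rowLen (α ++ β) (suc (A + y)) ≡ rowLen β (suc y)
  row-μ = rowLen-++ʳ α β y
  duality : suc y ≤ count (suc k) β ⇔ suc k ≤ rowLen β (suc y)
  duality = ferrers lb (s≤s z≤n) (s≤s z≤n)
  A<x : suc A ≤ suc (A + k)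
  A<x = s≤s (m≤m+n A k)
  to : InBoard (α ++ conj β) (suc (A + k)) (suc y) → TransformedBoard (suc A) 1 (α ++ β) (suc (A + k)) (suc y)
  to (_ , y≤) = inj₁ (A<x , s≤s z≤n , s≤s z≤n ,
    subst₂ _≤_ (cong suc (sym column)) (sym row-μ) (Equivalence.to duality (subst (suc y ≤_) row-ν y≤)))
  from : TransformedBoard (suc A) 1 (α ++ β) (suc (A + k)) (suc y) → InBoard (α ++ conj β) (suc (A + k)) (suc y)
  from (inj₁ (_ , _ , _ , k≤)) = s≤s z≤n ,
    subst (suc y ≤_) (sym row-ν) (Equivalence.from duality (subst₂ _≤_ (cong suc column) row-μ k≤))
  from (inj₂ (outside , _)) = contradiction (A<x , s≤s z≤n) outside

conjugateTail-partition : ∀ α {β} → IsPartition (α ++ β) → All (length β ≤_) α → IsPartition (α ++ conj β)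
conjugateTail-partition α {β} (positive , lk) above =
  All.++⁺ (All.++⁻ˡ α positive) (proj₁ conjβ) ,
  decreasing-++⁺ α (proj₁ (decreasing-++⁻ α lk)) (proj₂ conjβ)
    (subst (λ m → All (m ≤_) α) (sym (firstPart-conj positiveβ)) above)
  where
  positiveβ = All.++⁻ʳ α positive
  conjβ = conj-partition (partition-suffix α (positive , lk))

conjugateTail-isTransform : ∀ α b β' → IsPartition (α ++ b ∷ β') → All (length (b ∷ β') ≤_) α →
  IsTransform (suc (length α)) 1 (α ++ b ∷ β') (α ++ conj (b ∷ β'))
conjugateTail-isTransform α b β' P above = anchor , conjugateTail-partition α P above , board
  where
  A = length α
  β = b ∷ β'
  anchor : InBoard (α ++ β) (suc A) 1
  anchor = ≤-refl , subst (1 ≤_) (sym first-row) (All.head (proj₁ (partition-suffix α P)))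
    where
    first-row : rowLen (α ++ β) (suc A) ≡ b
    first-row = trans (cong (λ r → rowLen (α ++ β) (suc r)) (sym (+-identityʳ A))) (rowLen-++ʳ α β 0)
  board : ∀ x y → (InBoard (α ++ conj β) x y → TransformedBoard (suc A) 1 (α ++ β) x y)
                × (TransformedBoard (suc A) 1 (α ++ β) x y → InBoard (α ++ conj β) x y)
  board x zero = (λ { (() , _) }) , (λ { (inj₁ (_ , () , _)) ; (inj₂ (_ , () , _)) })
  board x (suc y) with x ≤? A
  ... | yes x≤A = conjugateTail-upper α β x≤A
  ... | no x≰A with m≤n⇒∃[o]m+o≡n (≰⇒> x≰A)
  ...   | k , refl = conjugateTail-lower α (proj₂ (partition-suffix α P)) k y

DiagBounded : ℕ → List ℕ → Set
DiagBounded K μ = ∀ x y → InBoard μ x y → x + y ≤ K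

-- A transform sends a box (x,y) of the subboard to (i + (y-j), j + (x-i)), which
-- lies on the same anti-diagonal; hence anti-diagonal bounds are invariant.
transform-preserves-diag : ∀ {i j μ ν K} → IsTransform i j μ ν → DiagBounded K μ → DiagBounded K ν
transform-preserves-diag {i} {j} {K = K} (_ , _ , board) bounded x y box with proj₁ (board x y) box
... | inj₂ (_ , box-μ)           = bounded x y box-μ
... | inj₁ (i≤x , j≤y , box-μ) = subst (_≤ K) swap (bounded _ _ box-μ)
  where
  open ≡-Reasoning
  rearrange : ∀ i j a b → (i + b) + (j + a) ≡ (i + a) + (j + b)
  rearrange = solve-∀
  swap : (i + (y ∸ j)) + (j + (x ∸ i)) ≡ x + y
  swap = begin
    (i + (y ∸ j)) + (j + (x ∸ i)) ≡⟨ rearrange i j (x ∸ i) (y ∸ j) ⟩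
    (i + (x ∸ i)) + (j + (y ∸ j)) ≡⟨ cong₂ _+_ (m+[n∸m]≡n i≤x) (m+[n∸m]≡n j≤y) ⟩
    x + y                         ∎

diagBounded-tail : ∀ {K a ρ} → DiagBounded (suc K) (a ∷ ρ) → DiagBounded K ρ
diagBounded-tail {a = a} {ρ} bounded x y (1≤y , y≤) =
  ≤-pred (bounded (suc x) y (1≤y , ≤-trans y≤ (row-shift ρ x)))
  where
  row-shift : ∀ ρ x → rowLen ρ x ≤ rowLen (a ∷ ρ) (suc x)
  row-shift []      zero    = z≤n
  row-shift (_ ∷ _) zero    = z≤n
  row-shift ρ       (suc x) = ≤-refl

-- maxDiag ρ = max over rows k (from 0) of ρ_k + k: the last anti-diagonal reached.
maxDiag : List ℕ → ℕ
maxDiag []      = 0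
maxDiag (a ∷ ρ) = a ⊔ suc (maxDiag ρ)

maxDiag-bounds : ∀ ρ → DiagBounded (suc (maxDiag ρ)) ρ
maxDiag-bounds []      x             y (1≤y , y≤0) = contradiction y≤0 (<⇒≱ 1≤y)
maxDiag-bounds (a ∷ ρ) zero          y (1≤y , y≤0) = contradiction y≤0 (<⇒≱ 1≤y)
maxDiag-bounds (a ∷ ρ) (suc zero)    y (_ , y≤a)   = s≤s (≤-trans y≤a (m≤m⊔n a _))
maxDiag-bounds (a ∷ ρ) (suc (suc k)) y box          =
  s≤s (≤-trans (maxDiag-bounds ρ (suc k) y box) (m≤n⊔m a _))

maxDiag-below : ∀ {M τ} → 1 ≤ M → All (1 ≤_) τ → DiagBounded M τ → maxDiag τ < M
maxDiag-below 1≤M []                  _       = 1≤M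
maxDiag-below {suc M} {c ∷ τ} _ (1≤c ∷ positive) bounded =
  s≤s (⊔-lub c≤M (maxDiag-below (≤-trans 1≤c c≤M) positive (diagBounded-tail bounded)))
  where
  c≤M : c ≤ M
  c≤M = ≤-pred (bounded 1 c (1≤c , ≤-refl))

-- The first column reaches anti-diagonal length ρ, so length ρ ≤ maxDiag ρ.
length≤maxDiag : ∀ ρ → length ρ ≤ maxDiag ρ
length≤maxDiag []      = z≤n
length≤maxDiag (a ∷ ρ) = ≤-trans (s≤s (length≤maxDiag ρ)) (m≤n⊔m a _)

record Peak (ρ : List ℕ) : Set where
  constructor peak
  field
    upper : List ℕ
    part  : ℕ
    lower : List ℕ
    split : ρ ≡ upper ++ part ∷ lower
    attains : part + length upper ≡ maxDiag ρ

maxDiag-attained : ∀ a ρ → All (1 ≤_) (a ∷ ρ) → Peak (a ∷ ρ)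
maxDiag-attained a ρ positive with suc (maxDiag ρ) ≤? a
... | yes rest<a = peak [] a ρ refl (trans (+-identityʳ a) (sym (m≥n⇒m⊔n≡m rest<a)))
maxDiag-attained a []      (1≤a ∷ _) | no 1≰a = contradiction 1≤a 1≰a
maxDiag-attained a (c ∷ ρ) (_ ∷ positive) | no rest≮a with maxDiag-attained c ρ positive
... | peak γ b β' split attains = peak (a ∷ γ) b β' (cong (a ∷_) split) (begin
  b + suc (length γ)        ≡⟨ +-suc b (length γ) ⟩
  suc (b + length γ)        ≡⟨ cong suc attains ⟩
  suc (maxDiag (c ∷ ρ))     ≡⟨ sym (m≤n⇒m⊔n≡n (<⇒≤ (≰⇒> rest≮a))) ⟩
  maxDiag (a ∷ c ∷ ρ)       ∎)
  where open ≡-Reasoning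

-- From a peak row b on there are at most b rows: otherwise the first column would
-- reach beyond the peak's anti-diagonal.
peak-lower-short : ∀ α b β' → b + length α ≡ maxDiag (α ++ b ∷ β') → length (b ∷ β') ≤ b
peak-lower-short α b β' attains = +-cancelˡ-≤ (length α) _ _ (begin
  length α + length (b ∷ β') ≡⟨ length-++ α ⟨
  length (α ++ b ∷ β')        ≤⟨ length≤maxDiag (α ++ b ∷ β') ⟩
  maxDiag (α ++ b ∷ β')       ≡⟨ attains ⟨
  b + length α                ≡⟨ +-comm b (length α) ⟩
  length α + b                ∎)
  where open ≤-Reasoning

record Conjugated (π α β : List ℕ) : Set where
  field
    step       : Step (π ++ α ++ β) (π ++ α ++ conj β)
    partition  : IsPartition (π ++ α ++ conj β)
    keeps-sum  : sum (α ++ conj β) ≡ sum (α ++ β)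
    keeps-diag : ∀ {K} → DiagBounded K (α ++ β) → DiagBounded K (α ++ conj β)

-- The basic move applied behind a prefix; the bound on the suffix comes from
-- reading the same move as a transform of the suffix alone.
conjugateTail-step : ∀ π α b β' → IsPartition (π ++ α ++ b ∷ β') → All (length (b ∷ β') ≤_) (π ++ α) →
  Conjugated π α (b ∷ β')
conjugateTail-step π α b β' P above = record
  { step       = subst₂ Step (++-assoc π α β) (++-assoc π α (conj β)) (_ , whole)
  ; partition  = subst IsPartition (++-assoc π α (conj β)) (proj₁ (proj₂ whole))
  ; keeps-sum  = begin
      sum (α ++ conj β)       ≡⟨ sum-++ α (conj β) ⟩
      sum α + sum (conj β)    ≡⟨ cong (sum α +_) (sum-conj (proj₂ (partition-suffix (π ++ α) P'))) ⟩
      sum α + sum β           ≡⟨ sum-++ α β ⟨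
      sum (α ++ β)            ∎
  ; keeps-diag = transform-preserves-diag {μ = α ++ β} suffix
  }
  where
  open ≡-Reasoning
  β = b ∷ β'
  P' : IsPartition ((π ++ α) ++ β)
  P' = subst IsPartition (sym (++-assoc π α β)) P
  whole = conjugateTail-isTransform (π ++ α) b β' P' above
  suffix = conjugateTail-isTransform α b β' (partition-suffix π P) (All.++⁻ʳ π above)

record Raised (π ρ : List ℕ) (M : ℕ) : Set where
  constructor raised
  field
    rest       : List ℕ
    steps      : Star Step (π ++ ρ) (π ++ M ∷ rest)
    partition  : IsPartition (π ++ M ∷ rest)
    sum-eq     : sum (M ∷ rest) ≡ sum ρ
    rest-below : maxDiag rest < M

-- Conjugating the rows from a peak row b on is legal: they number at most b, and
-- every part above them is at least b (those in π are at least M = b + |α|).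
peak-tail-legal : ∀ π α b β' → IsPartition (π ++ α ++ b ∷ β') → All (b + length α ≤_) π →
  b + length α ≡ maxDiag (α ++ b ∷ β') → All (length (b ∷ β') ≤_) (π ++ α)
peak-tail-legal π α b β' P above attains =
  All.++⁺ (All.map (≤-trans (≤-trans β≤b (m≤m+n b _))) above) (All.map (≤-trans β≤b) α-above-b)
  where
  β≤b = peak-lower-short α b β' attains
  α-above-b : All (b ≤_) α
  α-above-b = proj₂ (proj₂ (decreasing-++⁻ α (proj₂ (partition-suffix π P))))

-- Two conjugations raise the peak row: first conjugate b ∷ β', then the whole new
-- suffix ρ₁, whose length is M; its conjugate starts with M and, by the preserved
-- anti-diagonal bound, the remaining parts have maxDiag below M.
raise-peak : ∀ π c α' b β' → IsPartition (π ++ (c ∷ α') ++ b ∷ β') →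
  All (b + length (c ∷ α') ≤_) π → b + length (c ∷ α') ≡ maxDiag ((c ∷ α') ++ b ∷ β') →
  Raised π ((c ∷ α') ++ b ∷ β') (b + length (c ∷ α'))
raise-peak π c α' b β' P above attains =
  raised τ (A.step ◅ step-B ◅ ε) partition sum-eq (maxDiag-below 1≤M positive-τ (diagBounded-tail bounded))
  where
  α = c ∷ α'
  β = b ∷ β'
  ρ₁ = α ++ conj β
  M = b + length α
  module A = Conjugated (conjugateTail-step π α b β' P (peak-tail-legal π α b β' P above attains))
  ρ₁≡M : length ρ₁ ≡ M
  ρ₁≡M = trans (length-++ α) (trans (cong (length α +_) (length-conj β)) (+-comm (length α) b))
  module B = Conjugated (conjugateTail-step π [] c (α' ++ conj β) A.partition
    (All.++⁺ (subst (λ m → All (m ≤_) π) (sym ρ₁≡M) above) []))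
  head = conj-head (proj₁ (partition-suffix π A.partition))
  τ = proj₁ head
  shape : conj ρ₁ ≡ M ∷ τ
  shape = trans (proj₂ head) (cong (_∷ τ) ρ₁≡M)
  step-B : Step (π ++ ρ₁) (π ++ M ∷ τ)
  step-B = subst (λ σ → Step (π ++ ρ₁) (π ++ σ)) shape B.step
  partition : IsPartition (π ++ M ∷ τ)
  partition = subst (λ σ → IsPartition (π ++ σ)) shape B.partition
  sum-eq : sum (M ∷ τ) ≡ sum (α ++ β)
  sum-eq = trans (cong sum (sym shape)) (trans B.keeps-sum A.keeps-sum)
  bounded : DiagBounded (suc M) (M ∷ τ)
  bounded = subst (DiagBounded (suc M)) shape
    (B.keeps-diag (A.keeps-diag (subst (λ m → DiagBounded (suc m) (α ++ β)) (sym attains) (maxDiag-bounds _))))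
  1≤M : 1 ≤ M
  1≤M = ≤-trans (s≤s z≤n) (m≤n+m (length α) b)
  positive-τ : All (1 ≤_) τ
  positive-τ = All.tail (All.++⁻ʳ π (proj₁ partition))

raise : ∀ π a ρ → IsPartition (π ++ a ∷ ρ) → All (maxDiag (a ∷ ρ) ≤_) π → Raised π (a ∷ ρ) (maxDiag (a ∷ ρ))
raise π a ρ P above with maxDiag-attained a ρ (All.++⁻ʳ π (proj₁ P))
... | peak [] b β' refl attains = subst (Raised π (b ∷ β')) b≡M
        (raised β' ε P refl (subst (suc (maxDiag β') ≤_) (sym b≡M) (m≤n⊔m b _)))
  where
  b≡M : b ≡ maxDiag (b ∷ β')
  b≡M = trans (sym (+-identityʳ b)) attains
... | peak (c ∷ α') b β' refl attains = subst (Raised π _) attains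
        (raise-peak π c α' b β' P (subst (λ m → All (m ≤_) π) (sym attains) above) attains)

strictly-decreasing⇒strict : ∀ {σ} → Linked _>_ σ → IsStrict σ
strictly-decreasing⇒strict lk = AllPairs.map >⇒≢ (Linkedₚ.Linked⇒AllPairs (flip <-trans) lk)

record Strictified (π ρ : List ℕ) : Set where
  constructor strictified
  field
    result    : List ℕ
    steps     : Star Step (π ++ ρ) (π ++ result)
    strict    : Linked _>_ result
    sum-eq    : sum result ≡ sum ρ
    partition : IsPartition (π ++ result)
    first≤    : firstPart result ≤ maxDiag ρ

-- Raise the first part, freeze it into the prefix, and recurse on the rest;
-- the fuel bounds the sum of the suffix, which decreases at each round.
strictify : ∀ fuel π ρ → sum ρ ≤ fuel → IsPartition (π ++ ρ) → All (maxDiag ρ ≤_) π → Strictified π ρ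
strictify _ π [] _ P _ = strictified [] ε [] refl P z≤n
strictify zero π (a ∷ ρ) sum≤0 P _ =
  contradiction (≤-trans (≤-trans (All.head (All.++⁻ʳ π (proj₁ P))) (m≤m+n a (sum ρ))) sum≤0) (λ ())
strictify (suc fuel) π (a ∷ ρ) sum≤ P above with raise π a ρ P above
... | raised τ steps₁ P₁ sum₁ τ<M = prepend (strictify fuel (π ++ [ M ]) τ sum-τ≤ P' above')
  where
  M = maxDiag (a ∷ ρ)
  sum-τ≤ : sum τ ≤ fuel
  sum-τ≤ = ≤-pred (begin
    suc (sum τ)   ≤⟨ +-monoˡ-≤ (sum τ) (≤-trans (s≤s z≤n) τ<M) ⟩
    M + sum τ     ≡⟨ sum₁ ⟩
    sum (a ∷ ρ)   ≤⟨ sum≤ ⟩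
    suc fuel      ∎)
    where open ≤-Reasoning
  P' : IsPartition ((π ++ [ M ]) ++ τ)
  P' = subst IsPartition (sym (++-assoc π [ M ] τ)) P₁
  above' : All (maxDiag τ ≤_) (π ++ [ M ])
  above' = All.++⁺ (All.map (≤-trans (<⇒≤ τ<M)) above) (<⇒≤ τ<M ∷ [])
  link : ∀ σ → Linked _>_ σ → firstPart σ ≤ maxDiag τ → Linked _>_ (M ∷ σ)
  link []      _  _   = [-]
  link (_ ∷ _) lk s≤ = ≤-<-trans s≤ τ<M ∷ lk
  prepend : Strictified (π ++ [ M ]) τ → Strictified π (a ∷ ρ)
  prepend (strictified σ steps₂ strict sum₂ P₂ first≤) = strictified (M ∷ σ)
    (steps₁ ◅◅ subst₂ (Star Step) (++-assoc π [ M ] τ) (++-assoc π [ M ] σ) steps₂)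
    (link σ strict first≤) (trans (cong (M +_) sum₂) sum₁)
    (subst IsPartition (++-assoc π [ M ] σ) P₂) ≤-refl

-- Main theorem: strictify the whole partition behind the empty prefix.
lemma9 : (n : ℕ) → 1 ≤ n → (μ : List ℕ) → IsPartitionOf n μ →
    Σ (List ℕ) (λ ν → IsPartitionOf n ν × IsStrict ν × Equiv₁ μ ν)
lemma9 n _ μ (P , sum≡n) with strictify n [] μ (≤-reflexive sum≡n) P []
... | strictified σ steps strict sum-eq P′ _ =
  σ , (P′ , trans sum-eq sum≡n) , strictly-decreasing⇒strict strict , inj₁ steps
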